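{- Let $\mathcal{T}=(\mathcal{V},\mathcal{E})$ be a finite tree with geodesic distance $\mathcal{S}$, and let $m\ge 1$ be an integer. Let $\mathcal{T}^{\star}$ be the $(1,m)$-star-fractal tree of $\mathcal{T}$. Then the geodesic distance $\mathcal{S}^{\star}$ of $\mathcal{T}^{\star}$ is $$\mathcal{S}^{\star}=2(m+2)^{2}\mathcal{S}-(m+2)(|\mathcal{V}|-1)(m+|\mathcal{V}|).$$
   Context: For a connected finite graph $G$, its geodesic distance is $\mathcal{S}(G)=\sum_{\{u,v\}} d_G(u,v)$, the sum of the shortest-path distances over all unordered pairs of distinct vertices of $G$. The $(1,m)$-star-fractal graph of a graph $G=(\mathcal{V},\mathcal{E})$ is obtained by replacing every edge $uv\in\mathcal{E}$ by a path $uwv$ of length $2$ with a new vertex $w$ (distinct for each edge), and additionally attaching $m$ new pendant vertices to each such new vertex $w$ (all new vertices distinct). -}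

module Defs where

open import Data.Nat using (ℕ; zero; suc; _+_; _*_; _<_; _≤_; _<ᵇ_)
open import Data.Fin using (Fin; zero; suc; toℕ; inject₁; fromℕ; _↑ˡ_; _↑ʳ_; combine; remQuot)
open import Data.List using (map; allFin)
open import Data.Nat.ListAction using (sum)
open import Data.Product using (_×_; _,_; Σ; ∃; proj₁; proj₂)
open import Data.Sum using (_⊎_)
open import Data.Bool using (if_then_else_)
open import Function.Definitions using (Injective)
open import Relation.Binary.PropositionalEquality using (_≡_)
open import Relation.Nullary using (¬_)

-- A finite (multi)graph: vertex set Fin n, edge set Fin k, each edge given by
-- its (ordered, but read as unordered) pair of endpoints.
record Graph : Set where
  field
    n    : ℕ
    k    : ℕ
    ends : Fin k → Fin n × Fin n
open Graph public

Adj : (G : Graph) → Fin (n G) → Fin (n G) → Set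
Adj G u v = Σ (Fin (k G)) λ e → (ends G e ≡ (u , v)) ⊎ (ends G e ≡ (v , u))

data Walk (G : Graph) : Fin (n G) → Fin (n G) → ℕ → Set where
  here : ∀ {u} → Walk G u u 0
  step : ∀ {u v w l} → Adj G u v → Walk G v w l → Walk G u w (suc l)

IsSimple : Graph → Set
IsSimple G =
  (∀ e → ¬ (proj₁ (ends G e) ≡ proj₂ (ends G e))) ×
  (∀ e f → (ends G e ≡ ends G f) ⊎ (ends G e ≡ (proj₂ (ends G f) , proj₁ (ends G f))) → e ≡ f)

Connected : Graph → Set
Connected G = ∀ u v → ∃ λ l → Walk G u v l

Cycle : (G : Graph) → Set
Cycle G = Σ ℕ λ l → Σ (Fin (suc (suc (suc l))) → Fin (n G)) λ c →
  Injective _≡_ _≡_ c ×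
  (∀ (i : Fin (suc (suc l))) → Adj G (c (inject₁ i)) (c (suc i))) ×
  Adj G (c (fromℕ (suc (suc l)))) (c zero)

Acyclic : Graph → Set
Acyclic G = ¬ Cycle G

IsTree : Graph → Set
IsTree G = (1 ≤ n G) × IsSimple G × Connected G × Acyclic G

IsDistance : (G : Graph) → (Fin (n G) → Fin (n G) → ℕ) → Set
IsDistance G d = ∀ u v → Walk G u v (d u v) × (∀ l → Walk G u v l → d u v ≤ l)

-- Sum of d over unordered pairs {u,v}, u ≠ v (indexed as toℕ u < toℕ v)
pairSum : (N : ℕ) → (Fin N → Fin N → ℕ) → ℕ
pairSum N d = sum (map (λ u → sum (map (λ v → if toℕ u <ᵇ toℕ v then d u v else 0)
                                        (allFin N))) (allFin N))

GeodesicDistance : (G : Graph) → (Fin (n G) → Fin (n G) → ℕ) → ℕ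
GeodesicDistance G d = pairSum (n G) d

-- Vertices: Fin (n + (k + k*m)):  old vertex u ↦ u ↑ˡ _,
--   subdivision vertex of edge e ↦ n ↑ʳ (e ↑ˡ k*m),
--   t-th pendant vertex at edge e ↦ n ↑ʳ (k ↑ʳ combine e t).
-- Edges: Fin (k * (2+m)), edge index ↦ (e , j) via remQuot:
--   j = 0 : u–w_e,  j = 1 : w_e–v,  j = 2+t : w_e–p_{e,t}.
starFractal : ℕ → Graph → Graph
starFractal m G = record
  { n = n G + (k G + k G * m)
  ; k = k G * suc (suc m)
  ; ends = λ e' → edge (remQuot (suc (suc m)) e')
  }
  where
  N' = n G + (k G + k G * m)
  old : Fin (n G) → Fin N'
  old u = u ↑ˡ (k G + k G * m)
  mid : Fin (k G) → Fin N'
  mid e = n G ↑ʳ (e ↑ˡ (k G * m))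
  pend : Fin (k G) → Fin m → Fin N'
  pend e t = n G ↑ʳ (k G ↑ʳ combine e t)
  edge : Fin (k G) × Fin (suc (suc m)) → Fin N' × Fin N'
  edge (e , zero)          = old (proj₁ (ends G e)) , mid e
  edge (e , suc zero)      = mid e , old (proj₂ (ends G e))
  edge (e , suc (suc t))   = mid e , pend e t

DistFun : Graph → Set
DistFun G = Fin (n G) → Fin (n G) → ℕ

-- The distances in the star-fractal tree to a fixed vertex are potentials built from T. Towards an
-- old vertex v, an old vertex u lies at 2 d(u,v), the subdivision vertex of an edge e at
-- 1 + 2 min(d(e₁,v), d(e₂,v)) and its pendants one step further; towards the subdivision vertex of
-- an edge f the distance to v is replaced by the distance to f; and a pendant is one step beyond its
-- only neighbour. Such a potential is the distance as soon as it changes by at most one along edges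
-- and is realised by walks. Summing the distance matrix by columns leaves, besides sums of
-- distances in T, sums over the edges of T of the smaller height of their ends, the height being
-- the distance to a vertex or to an edge of T. In a tree every edge joins a vertex to its parent,
-- since otherwise two ancestor chains close a cycle, so such a sum is Σₓ h(x) minus the number of
-- non-roots; the formula then follows by linear arithmetic.
module Submission where

open import Defs
open import Relation.Binary.PropositionalEquality

module _ where

  open import Data.Nat
    using (ℕ; zero; suc; _+_; _*_; _∸_; _⊓_; _≤_; _<_; _≤?_; _<?_; _<ᵇ_; z≤n; s≤s)
  open import Data.Nat.Properties
  open import Data.Nat.Tactic.RingSolver using (solve-∀)
  open import Data.Fin using (Fin; zero; suc; toℕ; fromℕ<; inject₁; fromℕ; _↑ˡ_; _↑ʳ_; combine; remQuot; splitAt)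
  import Data.Fin.Properties as Finₚ
  open import Data.List using (map; allFin; tabulate)
  open import Data.List.Properties using (map-tabulate)
  import Data.Nat.ListAction as List
  open import Algebra.Properties.Semiring.Sum +-*-semiring
    using (sum; sum-syntax; sum-cong-≗; ∑-distrib-+; ∑-comm; *-distribˡ-sum; *-distribʳ-sum)
  open import Data.Bool using (true; false; T; if_then_else_)
  open import Data.Unit using (tt)
  open import Data.Empty using (⊥; ⊥-elim)
  open import Data.Product using (Σ; ∃; _×_; _,_; proj₁; proj₂; swap)
  open import Data.Product.Properties using (,-injective)
  open import Data.Sum using (_⊎_; inj₁; inj₂; [_,_]′)
  open import Function using (_∘_; id)
  open import Relation.Nullary using (Dec; yes; no; ¬_; does; contradiction)
  open import Relation.Nullary.Decidable using (dec-true; dec-false)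

  -- Finite sums

  sum-tabulate : ∀ N (f : Fin N → ℕ) → List.sum (tabulate f) ≡ ∑[ i < N ] f i
  sum-tabulate zero    f = refl
  sum-tabulate (suc N) f = cong (f zero +_) (sum-tabulate N (f ∘ suc))

  sum-allFin : ∀ N (f : Fin N → ℕ) → List.sum (map f (allFin N)) ≡ ∑[ i < N ] f i
  sum-allFin N f = trans (cong List.sum (map-tabulate id f)) (sum-tabulate N f)

  ∑-const : ∀ N c → ∑[ i < N ] c ≡ N * c
  ∑-const zero    c = refl
  ∑-const (suc N) c = cong (c +_) (∑-const N c)

  ∑-zero : ∀ N → ∑[ i < N ] 0 ≡ 0
  ∑-zero N = trans (∑-const N 0) (*-zeroʳ N)

  ∑-*ˡ : ∀ {N} c (f : Fin N → ℕ) → ∑[ i < N ] (c * f i) ≡ c * ∑[ i < N ] f i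
  ∑-*ˡ c f = sym (*-distribˡ-sum c f)

  ∑-affine : ∀ {N} a b (f : Fin N → ℕ) → ∑[ i < N ] (a + b * f i) ≡ N * a + b * ∑[ i < N ] f i
  ∑-affine {N} a b f = trans (∑-distrib-+ (λ _ → a) (λ i → b * f i)) (cong₂ _+_ (∑-const N a) (∑-*ˡ b f))

  ∑-++ : ∀ A B (f : Fin (A + B) → ℕ) →
    ∑[ i < A + B ] f i ≡ ∑[ i < A ] f (i ↑ˡ B) + ∑[ j < B ] f (A ↑ʳ j)
  ∑-++ zero    B f = refl
  ∑-++ (suc A) B f = trans (cong (f zero +_) (∑-++ A B (f ∘ suc))) (sym (+-assoc (f zero) _ _))

  ∑-combine : ∀ A B (f : Fin (A * B) → ℕ) →
    ∑[ k < A * B ] f k ≡ ∑[ i < A ] ∑[ j < B ] f (combine i j)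
  ∑-combine zero    B f = refl
  ∑-combine (suc A) B f =
    trans (∑-++ B (A * B) f) (cong (∑[ j < B ] f (j ↑ˡ (A * B)) +_) (∑-combine A B (λ k → f (B ↑ʳ k))))

  ∑-agree-except : ∀ {N} (f g : Fin N → ℕ) j → (∀ i → i ≢ j → f i ≡ g i) →
    ∑[ i < N ] f i + g j ≡ ∑[ i < N ] g i + f j
  ∑-agree-except {suc N} f g zero agree = begin
      f zero + sum (f ∘ suc) + g zero
    ≡⟨ cong (λ s → f zero + s + g zero) (sum-cong-≗ (λ i → agree (suc i) λ ())) ⟩
      f zero + sum (g ∘ suc) + g zero
    ≡⟨ swap₁₃ (f zero) (sum (g ∘ suc)) (g zero) ⟩
      g zero + sum (g ∘ suc) + f zero ∎
    where
    open ≡-Reasoning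
    swap₁₃ : ∀ a b c → a + b + c ≡ c + b + a
    swap₁₃ = solve-∀
  ∑-agree-except {suc N} f g (suc j) agree = begin
      f zero + sum (f ∘ suc) + g (suc j)
    ≡⟨ +-assoc (f zero) _ _ ⟩
      f zero + (sum (f ∘ suc) + g (suc j))
    ≡⟨ cong₂ _+_ (agree zero λ ())
         (∑-agree-except (f ∘ suc) (g ∘ suc) j (λ i i≢j → agree (suc i) (i≢j ∘ Finₚ.suc-injective))) ⟩
      g zero + (sum (g ∘ suc) + f (suc j))
    ≡⟨ +-assoc (g zero) _ _ ⟨
      g zero + sum (g ∘ suc) + f (suc j) ∎
    where open ≡-Reasoning

  ∑-support : ∀ {N} (f : Fin N → ℕ) j → (∀ i → i ≢ j → f i ≡ 0) → ∑[ i < N ] f i ≡ f j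
  ∑-support {N} f j outside = begin
    ∑[ i < N ] f i          ≡⟨ +-identityʳ _ ⟨
    ∑[ i < N ] f i + 0      ≡⟨ ∑-agree-except f (λ _ → 0) j outside ⟩
    ∑[ i < N ] 0 + f j      ≡⟨ cong (_+ f j) (∑-zero N) ⟩
    f j                     ∎
    where open ≡-Reasoning

  δ : ∀ {N} → Fin N → Fin N → ℕ
  δ i j = if does (i Finₚ.≟ j) then 1 else 0

  δ-refl : ∀ {N} (i : Fin N) → δ i i ≡ 1
  δ-refl i rewrite dec-true (i Finₚ.≟ i) refl = refl

  δ-≢ : ∀ {N} {i j : Fin N} → i ≢ j → δ i j ≡ 0
  δ-≢ {i = i} {j} i≢j rewrite dec-false (i Finₚ.≟ j) i≢j = refl

  ∑-δ* : ∀ {N} (y : Fin N) (w : Fin N → ℕ) → ∑[ x < N ] (δ y x * w x) ≡ w y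
  ∑-δ* y w = trans (∑-support _ y (λ x x≢y → cong (_* w x) (δ-≢ (x≢y ∘ sym))))
                   (trans (cong (_* w y) (δ-refl y)) (+-identityʳ (w y)))

  ∑-fibres : ∀ {K N} (f : Fin K → Fin N) (w : Fin N → ℕ) →
    ∑[ e < K ] w (f e) ≡ ∑[ x < N ] (∑[ e < K ] δ (f e) x * w x)
  ∑-fibres {K} {N} f w = begin
    ∑[ e < K ] w (f e)                       ≡⟨ sum-cong-≗ (λ e → ∑-δ* (f e) w) ⟨
    ∑[ e < K ] ∑[ x < N ] (δ (f e) x * w x)  ≡⟨ ∑-comm (λ e x → δ (f e) x * w x) ⟩
    ∑[ x < N ] ∑[ e < K ] (δ (f e) x * w x)  ≡⟨ sum-cong-≗ (λ x → *-distribʳ-sum (w x) (λ e → δ (f e) x)) ⟨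
    ∑[ x < N ] (∑[ e < K ] δ (f e) x * w x)  ∎
    where open ≡-Reasoning

  module _ {N} (d : Fin N → Fin N → ℕ) (d-sym : ∀ u v → d u v ≡ d v u) (d-refl : ∀ u → d u u ≡ 0) where

    private
      upper : Fin N → Fin N → ℕ
      upper u v = if toℕ u <ᵇ toℕ v then d u v else 0

      <ᵇ-true : ∀ {a b} → (a <ᵇ b) ≡ true → a < b
      <ᵇ-true {a} {b} eq = <ᵇ⇒< a b (subst T (sym eq) tt)

      <ᵇ-false : ∀ {a b} → (a <ᵇ b) ≡ false → b ≤ a
      <ᵇ-false eq = ≮⇒≥ (λ a<b → subst T eq (<⇒<ᵇ a<b))

      upper-split : ∀ u v → d u v ≡ upper u v + upper v u
      upper-split u v with toℕ u <ᵇ toℕ v in u<v | toℕ v <ᵇ toℕ u in v<u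
      ... | true  | true  = contradiction (<ᵇ-true {toℕ v} v<u) (<⇒≯ (<ᵇ-true {toℕ u} u<v))
      ... | true  | false = sym (+-identityʳ _)
      ... | false | true  = d-sym u v
      ... | false | false =
        trans (cong (d u) (Finₚ.toℕ-injective (≤-antisym (<ᵇ-false {toℕ u} u<v) (<ᵇ-false {toℕ v} v<u)))) (d-refl u)

    ∑∑≡2*pairSum : ∑[ u < N ] ∑[ v < N ] d u v ≡ 2 * pairSum N d
    ∑∑≡2*pairSum = begin
        ∑[ u < N ] ∑[ v < N ] d u v
      ≡⟨ sum-cong-≗ (λ u → trans (sum-cong-≗ (upper-split u)) (∑-distrib-+ (upper u) (λ v → upper v u))) ⟩
        ∑[ u < N ] (P u + ∑[ v < N ] upper v u)
      ≡⟨ ∑-distrib-+ P (λ u → ∑[ v < N ] upper v u) ⟩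
        ∑[ u < N ] P u + ∑[ u < N ] ∑[ v < N ] upper v u
      ≡⟨ cong (∑[ u < N ] P u +_) (∑-comm (λ u v → upper v u)) ⟩
        ∑[ u < N ] P u + ∑[ u < N ] P u
      ≡⟨ cong (∑[ u < N ] P u +_) (+-identityʳ _) ⟨
        2 * ∑[ u < N ] P u
      ≡⟨ cong (2 *_) (trans (sum-allFin N _) (sum-cong-≗ (λ u → sum-allFin N (upper u)))) ⟨
        2 * pairSum N d ∎
      where
      open ≡-Reasoning
      P : Fin N → ℕ
      P u = ∑[ v < N ] upper u v

  -- Walks and shortest paths

  Joins : (G : Graph) → Fin (k G) → Fin (n G) → Fin (n G) → Set
  Joins G e u v = (ends G e ≡ (u , v)) ⊎ (ends G e ≡ (v , u))

  module _ {G : Graph} where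

    adj-sym : ∀ {u v} → Adj G u v → Adj G v u
    adj-sym (e , inj₁ p) = e , inj₂ p
    adj-sym (e , inj₂ p) = e , inj₁ p

    infixr 5 _++ʷ_
    infixl 5 _∷ʳʷ_

    _++ʷ_ : ∀ {u v w l l'} → Walk G u v l → Walk G v w l' → Walk G u w (l + l')
    here     ++ʷ q = q
    step a p ++ʷ q = step a (p ++ʷ q)

    _∷ʳʷ_ : ∀ {u v w l} → Walk G u v l → Adj G v w → Walk G u w (suc l)
    _∷ʳʷ_ {l = l} p a = subst (Walk G _ _) (+-comm l 1) (p ++ʷ step a here)

    reverseʷ : ∀ {u v l} → Walk G u v l → Walk G v u l
    reverseʷ here       = here
    reverseʷ (step a p) = reverseʷ p ∷ʳʷ adj-sym a

    walk-⊓ : ∀ {u v a b} → Walk G u v a → Walk G u v b → Walk G u v (a ⊓ b)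
    walk-⊓ {a = a} {b} p q with ≤-total a b
    ... | inj₁ a≤b = subst (Walk G _ _) (sym (m≤n⇒m⊓n≡m a≤b)) p
    ... | inj₂ b≤a = subst (Walk G _ _) (sym (m≥n⇒m⊓n≡n b≤a)) q

    module _ (simple : IsSimple G) where

      adj-irrefl : ∀ {u v} → Adj G u v → u ≢ v
      adj-irrefl (e , inj₁ p) refl = proj₁ simple e (trans (cong proj₁ p) (sym (cong proj₂ p)))
      adj-irrefl (e , inj₂ p) refl = proj₁ simple e (trans (cong proj₁ p) (sym (cong proj₂ p)))

      joins-unique : ∀ {e f u v} → Joins G e u v → Joins G f u v → e ≡ f
      joins-unique (inj₁ p) (inj₁ q) = proj₂ simple _ _ (inj₁ (trans p (sym q)))
      joins-unique (inj₁ p) (inj₂ q) = proj₂ simple _ _ (inj₂ (trans p (sym (cong swap q))))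
      joins-unique (inj₂ p) (inj₁ q) = proj₂ simple _ _ (inj₂ (trans p (sym (cong swap q))))
      joins-unique (inj₂ p) (inj₂ q) = proj₂ simple _ _ (inj₁ (trans p (sym q)))

  same-ends : ∀ {G e u v u' v'} → Joins G e u v → Joins G e u' v' → (u ≡ u' × v ≡ v') ⊎ (u ≡ v' × v ≡ u')
  same-ends (inj₁ p) (inj₁ q) = inj₁ (,-injective (trans (sym p) q))
  same-ends (inj₁ p) (inj₂ q) = inj₂ (,-injective (trans (sym p) q))
  same-ends (inj₂ p) (inj₁ q) = inj₂ (swap (,-injective (trans (sym p) q)))
  same-ends (inj₂ p) (inj₂ q) = inj₁ (swap (,-injective (trans (sym p) q)))

  Close : ℕ → ℕ → Set
  Close a b = a ≤ suc b × b ≤ suc a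

  lipschitz-from-edges : ∀ {G} (F : Fin (n G) → ℕ) →
    (∀ e → Close (F (proj₁ (ends G e))) (F (proj₂ (ends G e)))) →
    ∀ {x y} → Adj G x y → F x ≤ suc (F y)
  lipschitz-from-edges F close (e , inj₁ p) =
    subst (λ (xy : _ × _) → F (proj₁ xy) ≤ suc (F (proj₂ xy))) p (proj₁ (close e))
  lipschitz-from-edges F close (e , inj₂ p) =
    subst (λ (yx : _ × _) → F (proj₂ yx) ≤ suc (F (proj₁ yx))) p (proj₂ (close e))

  close-suc : ∀ {a b} → Close a b → Close (suc a) (suc b)
  close-suc (a≤ , b≤) = s≤s a≤ , s≤s b≤

  double-≤ : ∀ {a b} → a ≤ suc b → 2 * a ≤ 2 + 2 * b
  double-≤ {a} {b} a≤1+b = ≤-trans (*-monoʳ-≤ 2 a≤1+b) (≤-reflexive (*-suc 2 b))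

  close-min : ∀ {p q} → p ≤ suc q → q ≤ suc p →
    Close (2 * p) (suc (2 * (p ⊓ q))) × Close (suc (2 * (p ⊓ q))) (2 * q)
  close-min {p} {q} p≤1+q q≤1+p with ≤-total p q
  ... | inj₁ p≤q rewrite m≤n⇒m⊓n≡m p≤q =
    (≤-trans (n≤1+n _) (n≤1+n _) , ≤-refl) , (s≤s (*-monoʳ-≤ 2 p≤q) , double-≤ q≤1+p)
  ... | inj₂ q≤p rewrite m≥n⇒m⊓n≡n q≤p =
    (double-≤ p≤1+q , s≤s (*-monoʳ-≤ 2 q≤p)) , (≤-refl , ≤-trans (n≤1+n _) (n≤1+n _))

  module ShortestPaths (G : Graph) (d : DistFun G) (d-is-distance : IsDistance G d) where

    geodesic : ∀ u v → Walk G u v (d u v)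
    geodesic u v = proj₁ (d-is-distance u v)

    d-minimal : ∀ {u v l} → Walk G u v l → d u v ≤ l
    d-minimal {u} {v} {l} = proj₂ (d-is-distance u v) l

    d-sym : ∀ u v → d u v ≡ d v u
    d-sym u v = ≤-antisym (d-minimal (reverseʷ (geodesic v u))) (d-minimal (reverseʷ (geodesic u v)))

    d-refl : ∀ u → d u u ≡ 0
    d-refl u = n≤0⇒n≡0 (d-minimal here)

    d≡0⇒≡ : ∀ {u v} → d u v ≡ 0 → u ≡ v
    d≡0⇒≡ {u} {v} eq = length-zero (subst (Walk G u v) eq (geodesic u v))
      where
      length-zero : Walk G u v 0 → u ≡ v
      length-zero here = refl

    d-lipschitz : ∀ {x y} v → Adj G x y → d x v ≤ suc (d y v)
    d-lipschitz v a = d-minimal (step a (geodesic _ v))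

    geodesic-step : ∀ x v → 0 < d x v → Σ (Fin (n G)) λ y → Adj G x y × d y v < d x v
    geodesic-step x v = first-step (geodesic x v)
      where
      first-step : ∀ {l} → Walk G x v l → 0 < l → Σ (Fin (n G)) λ y → Adj G x y × d y v < l
      first-step (step {v = y} a p) _ = y , a , s≤s (d-minimal p)

    potential-is-distance : ∀ {y} (F : Fin (n G) → ℕ) →
      (∀ {x x'} → Adj G x x' → F x ≤ suc (F x')) → F y ≡ 0 → (∀ x → Walk G x y (F x)) →
      ∀ x → d x y ≡ F x
    potential-is-distance {y} F F-lipschitz F-y F-walk x =
      ≤-antisym (d-minimal (F-walk x)) (below (geodesic x y))
      where
      below : ∀ {x l} → Walk G x y l → F x ≤ l
      below here       = ≤-reflexive F-y
      below (step a p) = ≤-trans (F-lipschitz a) (s≤s (below p))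

    distance-to-leaf : ∀ {w y} → Adj G w y → (∀ {x} → Adj G x y → x ≡ w) →
      ∀ {x} → x ≢ y → d x y ≡ suc (d x w)
    distance-to-leaf {w} {y} w~y only-w {x} x≢y =
      ≤-antisym (d-minimal (geodesic x w ∷ʳʷ w~y)) (through-w (geodesic x y) x≢y)
      where
      through-w : ∀ {x l} → Walk G x y l → x ≢ y → suc (d x w) ≤ l
      through-w here x≢y = contradiction refl x≢y
      through-w (step {v = x'} a p) _ with x' Finₚ.≟ y
      ... | yes refl  = s≤s (subst (_≤ _) (sym (trans (cong (λ z → d z w) (only-w a)) (d-refl w))) z≤n)
      ... | no x'≢y   = s≤s (≤-trans (d-lipschitz w a) (through-w p x'≢y))

  -- Cycles

  module _ {G : Graph} (α β : ℕ → Fin (n G)) {i j l : ℕ} (i+j≡1+l : i + j ≡ suc l)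
    (α-injective : ∀ {s s'} → s ≤ i → s' ≤ i → α s ≡ α s' → s ≡ s')
    (β-injective : ∀ {t t'} → t ≤ j → t' ≤ j → β t ≡ β t' → t ≡ t')
    (disjoint : ∀ {s t} → s ≤ i → t ≤ j → α s ≢ β t)
    (α-path : ∀ {s} → s < i → Adj G (α s) (α (suc s)))
    (β-path : ∀ {t} → t < j → Adj G (β t) (β (suc t)))
    (bottom : Adj G (α 0) (β 0))
    (top : Adj G (α i) (β j)) where

    private
      -- γ runs through α 0, …, α i and then β j, …, β 0.
      γ : ℕ → Fin (n G)
      γ r with r ≤? i
      ... | yes _ = α r
      ... | no _  = β (j ∸ (r ∸ suc i))

      γ-α : ∀ {r} → r ≤ i → γ r ≡ α r
      γ-α {r} r≤i with r ≤? i
      ... | yes _  = refl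
      ... | no r≰i = contradiction r≤i r≰i

      γ-β : ∀ t → γ (suc i + t) ≡ β (j ∸ t)
      γ-β t with suc i + t ≤? i
      ... | yes le = contradiction (≤-trans (s≤s (m≤m+n i t)) le) (<-irrefl refl)
      ... | no _   = cong (λ z → β (j ∸ z)) (m+n∸m≡n (suc i) t)

      data Segment (r : ℕ) : Set where
        first  : r ≤ i → Segment r
        second : ∀ t → r ≡ suc i + t → Segment r

      segment : ∀ r → Segment r
      segment r with r ≤? i
      ... | yes r≤i = first r≤i
      ... | no r≰i  = let (t , eq) = m≤n⇒∃[o]m+o≡n (≰⇒> r≰i) in second t (sym eq)

      second-bound : ∀ t → suc i + t ≤ i + suc j → t ≤ j
      second-bound t le = +-cancelˡ-≤ (suc i) t j (≤-trans le (≤-reflexive (+-suc i j)))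

      γ-injective : ∀ {r r'} → r ≤ i + suc j → r' ≤ i + suc j → γ r ≡ γ r' → r ≡ r'
      γ-injective {r} {r'} r≤ r'≤ eq with segment r | segment r'
      ... | first s≤i | first s'≤i =
        α-injective s≤i s'≤i (trans (sym (γ-α s≤i)) (trans eq (γ-α s'≤i)))
      ... | first s≤i | second t' refl =
        contradiction (trans (sym (γ-α s≤i)) (trans eq (γ-β t'))) (disjoint s≤i (m∸n≤m j t'))
      ... | second t refl | first s'≤i =
        contradiction (trans (sym (γ-α s'≤i)) (trans (sym eq) (γ-β t))) (disjoint s'≤i (m∸n≤m j t))
      ... | second t refl | second t' refl =
        cong (suc i +_) (∸-cancelˡ-≡ (second-bound t r≤) (second-bound t' r'≤)
          (β-injective (m∸n≤m j t) (m∸n≤m j t') (trans (sym (γ-β t)) (trans eq (γ-β t')))))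

      γ-adj : ∀ r → r ≤ i + j → Adj G (γ r) (γ (suc r))
      γ-adj r r≤ with segment r
      γ-adj r r≤ | first r≤i with m≤n⇒m<n∨m≡n r≤i
      ... | inj₁ r<i  = subst₂ (Adj G) (sym (γ-α r≤i)) (sym (γ-α r<i)) (α-path r<i)
      ... | inj₂ refl = subst₂ (Adj G) (sym (γ-α r≤i))
                          (sym (trans (cong γ (sym (+-identityʳ (suc i)))) (γ-β 0))) top
      γ-adj r r≤ | second t refl =
        subst₂ (Adj G) (sym (γ-β t)) (sym (trans (cong γ (sym (+-suc (suc i) t))) (γ-β (suc t))))
          (subst (λ z → Adj G (β z) (β (j ∸ suc t))) (sym j∸t≡1+j∸1+t)
            (adj-sym (β-path (≤-trans (≤-reflexive (sym j∸t≡1+j∸1+t)) (m∸n≤m j t)))))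
        where
        t<j : t < j
        t<j = +-cancelˡ-≤ (suc i) (suc t) j (≤-trans (≤-reflexive (+-suc (suc i) t)) (s≤s r≤))
        j∸t≡1+j∸1+t : j ∸ t ≡ suc (j ∸ suc t)
        j∸t≡1+j∸1+t = +-∸-assoc 1 t<j

    cycle-of-paths : Cycle G
    cycle-of-paths = l , c , c-injective , c-adj , c-closes
      where
      c : Fin (suc (suc (suc l))) → Fin (n G)
      c q = γ (toℕ q)

      bound : ∀ (q : Fin (suc (suc (suc l)))) → toℕ q ≤ i + suc j
      bound q = ≤-trans (≤-pred (Finₚ.toℕ<n q)) (≤-reflexive (sym (trans (+-suc i j) (cong suc i+j≡1+l))))

      c-injective : ∀ {q q'} → c q ≡ c q' → q ≡ q'
      c-injective {q} {q'} eq = Finₚ.toℕ-injective (γ-injective (bound q) (bound q') eq)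

      c-adj : ∀ (q : Fin (suc (suc l))) → Adj G (c (inject₁ q)) (c (suc q))
      c-adj q = subst (λ z → Adj G (γ z) (γ (suc (toℕ q)))) (sym (Finₚ.toℕ-inject₁ q))
                  (γ-adj (toℕ q) (≤-trans (≤-pred (Finₚ.toℕ<n q)) (≤-reflexive (sym i+j≡1+l))))

      c-closes : Adj G (c (fromℕ (suc (suc l)))) (c zero)
      c-closes = subst₂ (Adj G) (sym γ-last) (sym (γ-α z≤n)) (adj-sym bottom)
        where
        γ-last : γ (toℕ (fromℕ (suc (suc l)))) ≡ β 0
        γ-last = trans (cong γ (trans (Finₚ.toℕ-fromℕ (suc (suc l))) (cong suc (sym i+j≡1+l))))
                       (trans (γ-β j) (cong β (n∸n≡0 j)))

  -- Heights in a simple acyclic graph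

  greatest-below : {P : ℕ → Set} → (∀ ℓ → Dec (P ℓ)) → ∀ N →
    (∃ λ ℓ → ℓ ≤ N × P ℓ × (∀ {ℓ'} → ℓ < ℓ' → ℓ' ≤ N → ¬ P ℓ')) ⊎ (∀ {ℓ} → ℓ ≤ N → ¬ P ℓ)
  greatest-below P? zero with P? 0
  ... | yes p  = inj₁ (0 , z≤n , p , λ 0<ℓ ℓ≤0 → contradiction (≤-trans 0<ℓ ℓ≤0) λ ())
  ... | no ¬p = inj₂ λ { z≤n → ¬p }
  greatest-below {P} P? (suc N) with P? (suc N)
  ... | yes p  = inj₁ (suc N , ≤-refl , p , λ lt le → contradiction (≤-trans lt le) 1+n≰n)
  ... | no ¬p with greatest-below P? N
  ...   | inj₁ (ℓ , ℓ≤N , p , above) = inj₁ (ℓ , m≤n⇒m≤1+n ℓ≤N , p , above′)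
    where
    above′ : ∀ {ℓ'} → ℓ < ℓ' → ℓ' ≤ suc N → ¬ P ℓ'
    above′ lt le with m≤n⇒m<n∨m≡n le
    ... | inj₁ lt′ = above lt (≤-pred lt′)
    ... | inj₂ refl = ¬p
  ...   | inj₂ none = inj₂ none′
    where
    none′ : ∀ {ℓ} → ℓ ≤ suc N → ¬ P ℓ
    none′ le with m≤n⇒m<n∨m≡n le
    ... | inj₁ lt′ = none (≤-pred lt′)
    ... | inj₂ refl = ¬p

  module Layering {G : Graph} (simple : IsSimple G) (acyclic : Acyclic G)
    (h : Fin (n G) → ℕ)
    (h-lipschitz : ∀ {x y} → Adj G x y → h x ≤ suc (h y))
    (descent : ∀ x → 0 < h x → Σ (Fin (n G)) λ y → Adj G x y × h y < h x)
    (roots-adjacent : ∀ {x y} → h x ≡ 0 → h y ≡ 0 → x ≢ y → Adj G x y) where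

    private
      V : Set
      V = Fin (n G)

    parent : V → V
    parent x with 0 <? h x
    ... | yes h>0 = proj₁ (descent x h>0)
    ... | no _    = x

    parent-adj : ∀ {x} → 0 < h x → Adj G x (parent x)
    parent-adj {x} h>0 with 0 <? h x
    ... | yes h>0′ = proj₁ (proj₂ (descent x h>0′))
    ... | no h≯0   = contradiction h>0 h≯0

    parent-height : ∀ {x} → 0 < h x → suc (h (parent x)) ≡ h x
    parent-height {x} h>0 with 0 <? h x
    ... | yes h>0′ = let (_ , x~y , hy<hx) = descent x h>0′ in ≤-antisym hy<hx (h-lipschitz x~y)
    ... | no h≯0   = contradiction h>0 h≯0

    ancestor : ℕ → V → V
    ancestor zero    x = x
    ancestor (suc s) x = parent (ancestor s x)

    ancestor-height : ∀ s x → s ≤ h x → h (ancestor s x) + s ≡ h x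
    ancestor-positive : ∀ s x → s < h x → 0 < h (ancestor s x)

    ancestor-height zero    x _   = +-identityʳ _
    ancestor-height (suc s) x s<h =
      trans (+-suc _ s) (trans (cong (_+ s) (parent-height (ancestor-positive s x s<h)))
                               (ancestor-height s x (<⇒≤ s<h)))

    ancestor-positive s x s<h =
      n≢0⇒n>0 λ h≡0 → <-irrefl (trans (cong (_+ s) (sym h≡0)) (ancestor-height s x (<⇒≤ s<h))) s<h

    ancestor-adj : ∀ {s x} → s < h x → Adj G (ancestor s x) (ancestor (suc s) x)
    ancestor-adj {s} {x} s<h = parent-adj (ancestor-positive s x s<h)

    ancestor-injective : ∀ x {s s'} → s ≤ h x → s' ≤ h x → ancestor s x ≡ ancestor s' x → s ≡ s'
    ancestor-injective x {s} {s'} s≤ s'≤ eq = +-cancelˡ-≡ (h (ancestor s x)) s s'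
      (trans (ancestor-height s x s≤) (trans (sym (ancestor-height s' x s'≤)) (cong (λ z → h z + s') (sym eq))))

    root-of : ∀ x → h (ancestor (h x) x) ≡ 0
    root-of x = +-cancelʳ-≡ (h x) _ 0 (ancestor-height (h x) x ≤-refl)

    level : V → ℕ → V
    level x ℓ = ancestor (h x ∸ ℓ) x

    level-of-ancestor : ∀ {s x} → s ≤ h x → level x (h (ancestor s x)) ≡ ancestor s x
    level-of-ancestor {s} {x} s≤ = cong (λ z → ancestor z x)
      (trans (cong (_∸ h (ancestor s x)) (sym (ancestor-height s x s≤))) (m+n∸m≡n (h (ancestor s x)) s))

    ChildOf : V → V → Set
    ChildOf a b = parent a ≡ b × suc (h b) ≡ h a

    -- Were b not the parent of a, the ancestor chains of a and b, followed up to the highest level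
    -- at which they meet (or up to two distinct, hence adjacent, roots), would close a cycle with ab.
    module _ {a b} (a~b : Adj G a b) (hb≤ha : h b ≤ h a) (ha>0 : 0 < h a) where

      private
        Meet : ℕ → Set
        Meet ℓ = level a ℓ ≡ level b ℓ

        disjoint-above : ∀ {ℓ₀} → ℓ₀ ≤ h a → (∀ {ℓ} → ℓ₀ ≤ ℓ → ℓ ≤ h b → ¬ Meet ℓ) →
          ∀ {s t} → s ≤ h a ∸ ℓ₀ → t ≤ h b → ancestor s a ≢ ancestor t b
        disjoint-above {ℓ₀} ℓ₀≤ha no-meet {s} {t} s≤ t≤hb eq = no-meet ℓ₀≤ℓ ℓ≤hb meet
          where
          s≤ha : s ≤ h a
          s≤ha = ≤-trans s≤ (m∸n≤m (h a) ℓ₀)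
          same-height : h (ancestor s a) ≡ h (ancestor t b)
          same-height = cong h eq
          meet : Meet (h (ancestor s a))
          meet = trans (level-of-ancestor s≤ha)
                   (trans eq (sym (trans (cong (level b) same-height) (level-of-ancestor t≤hb))))
          ℓ≤hb : h (ancestor s a) ≤ h b
          ℓ≤hb = ≤-trans (≤-reflexive same-height)
                   (≤-trans (m≤m+n _ t) (≤-reflexive (ancestor-height t b t≤hb)))
          ℓ₀≤ℓ : ℓ₀ ≤ h (ancestor s a)
          ℓ₀≤ℓ = +-cancelʳ-≤ s ℓ₀ _ (≤-trans (+-monoʳ-≤ ℓ₀ s≤)
                   (≤-reflexive (trans (m+[n∸m]≡n ℓ₀≤ha) (sym (ancestor-height s a s≤ha)))))

        chains : ∀ {i j l} → i + j ≡ suc l → i ≤ h a → j ≤ h b →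
          (∀ {s t} → s ≤ i → t ≤ j → ancestor s a ≢ ancestor t b) →
          Adj G (ancestor i a) (ancestor j b) → ⊥
        chains i+j≡1+l i≤ha j≤hb disjoint top = acyclic (cycle-of-paths (λ s → ancestor s a) (λ t → ancestor t b)
          i+j≡1+l
          (λ s≤i s'≤i → ancestor-injective a (≤-trans s≤i i≤ha) (≤-trans s'≤i i≤ha))
          (λ t≤j t'≤j → ancestor-injective b (≤-trans t≤j j≤hb) (≤-trans t'≤j j≤hb))
          disjoint
          (λ s<i → ancestor-adj (<-≤-trans s<i i≤ha))
          (λ t<j → ancestor-adj (<-≤-trans t<j j≤hb))
          a~b top)

        separate-roots : (∀ {ℓ} → ℓ ≤ h b → ¬ Meet ℓ) → ⊥
        separate-roots never = chains (sym (proj₂ ha+hb≡1+l)) ≤-refl ≤-refl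
          (disjoint-above z≤n (λ _ → never))
          (roots-adjacent (root-of a) (root-of b) (never z≤n))
          where
          ha+hb≡1+l : ∃ λ l → 1 + l ≡ h a + h b
          ha+hb≡1+l = m≤n⇒∃[o]m+o≡n (≤-trans ha>0 (m≤m+n (h a) (h b)))

        meeting : ∀ ℓ* → ℓ* ≤ h b → Meet ℓ* → (∀ {ℓ} → ℓ* < ℓ → ℓ ≤ h b → ¬ Meet ℓ) → ℓ* < h a →
          ChildOf a b
        meeting ℓ* ℓ*≤hb meet above ℓ*<ha = by-length (i + j) refl
          where
          i j : ℕ
          i = h a ∸ suc ℓ*
          j = h b ∸ ℓ*
          ha∸ℓ*≡1+i : h a ∸ ℓ* ≡ suc i
          ha∸ℓ*≡1+i = +-∸-assoc 1 ℓ*<ha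
          i<ha : i < h a
          i<ha = ≤-trans (≤-reflexive (sym ha∸ℓ*≡1+i)) (m∸n≤m (h a) ℓ*)
          meet-point : ancestor (suc i) a ≡ ancestor j b
          meet-point = trans (cong (λ z → ancestor z a) (sym ha∸ℓ*≡1+i)) meet

          by-length : ∀ L → i + j ≡ L → ChildOf a b
          by-length zero i+j≡0 = parent-a≡b , 1+hb≡ha
            where
            i≡0 : i ≡ 0
            i≡0 = m+n≡0⇒m≡0 i i+j≡0
            j≡0 : j ≡ 0
            j≡0 = m+n≡0⇒n≡0 i i+j≡0
            parent-a≡b : parent a ≡ b
            parent-a≡b = trans (cong (λ z → ancestor (suc z) a) (sym i≡0))
                           (trans meet-point (cong (λ z → ancestor z b) j≡0))
            hb≡ℓ* : h b ≡ ℓ*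
            hb≡ℓ* = ≤-antisym (m∸n≡0⇒m≤n j≡0) ℓ*≤hb
            1+hb≡ha : suc (h b) ≡ h a
            1+hb≡ha = trans (cong suc hb≡ℓ*)
                        (trans (cong (_+ ℓ*) (sym (trans ha∸ℓ*≡1+i (cong suc i≡0)))) (m∸n+n≡m (<⇒≤ ℓ*<ha)))
          by-length (suc l) i+j≡1+l = ⊥-elim (chains i+j≡1+l (<⇒≤ i<ha) (m∸n≤m (h b) ℓ*)
            (λ s≤i t≤j → disjoint-above ℓ*<ha above s≤i (≤-trans t≤j (m∸n≤m (h b) ℓ*)))
            (subst (Adj G (ancestor i a)) meet-point (ancestor-adj i<ha)))

      child-of-edge : ChildOf a b
      child-of-edge with greatest-below (λ ℓ → level a ℓ Finₚ.≟ level b ℓ) (h b)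
      ... | inj₂ never = ⊥-elim (separate-roots never)
      ... | inj₁ (ℓ* , ℓ*≤hb , meet , above) with m≤n⇒m<n∨m≡n (≤-trans ℓ*≤hb hb≤ha)
      ...   | inj₁ ℓ*<ha = meeting ℓ* ℓ*≤hb meet above ℓ*<ha
      ...   | inj₂ refl  = contradiction a≡b (adj-irrefl simple a~b)
        where
        a≡b : a ≡ b
        a≡b = trans (cong (λ z → ancestor z a) (sym (n∸n≡0 (h a))))
                (trans meet (cong (λ z → ancestor z b) (m≤n⇒m∸n≡0 hb≤ha)))

    private
      src tgt : Fin (k G) → V
      src e = proj₁ (ends G e)
      tgt e = proj₂ (ends G e)

    child-end : Fin (k G) → V
    child-end e with h (tgt e) ≤? h (src e)
    ... | yes _ = src e
    ... | no _  = tgt e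

    child-end-joins : ∀ e → Σ V λ y → Joins G e (child-end e) y × h y ≤ h (child-end e)
    child-end-joins e with h (tgt e) ≤? h (src e)
    ... | yes t≤s = tgt e , inj₁ refl , t≤s
    ... | no t≰s  = src e , inj₂ refl , <⇒≤ (≰⇒> t≰s)

    child-end-max : ∀ e → h (src e) ≤ h (child-end e) × h (tgt e) ≤ h (child-end e)
    child-end-max e with h (tgt e) ≤? h (src e)
    ... | yes t≤s = ≤-refl , t≤s
    ... | no t≰s  = <⇒≤ (≰⇒> t≰s) , ≤-refl

    min-height : ∀ e → h (src e) ⊓ h (tgt e) ≡ h (child-end e) ∸ 1
    min-height e with child-end-joins e
    ... | y , J , hy≤ = trans (⊓-ends J) (trans (m≥n⇒m⊓n≡n hy≤) (below (e , J) hy≤))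
      where
      ⊓-ends : ∀ {x y} → Joins G e x y → h (src e) ⊓ h (tgt e) ≡ h x ⊓ h y
      ⊓-ends (inj₁ p) = cong (λ (q : V × V) → h (proj₁ q) ⊓ h (proj₂ q)) p
      ⊓-ends {x} {y} (inj₂ p) = trans (cong (λ (q : V × V) → h (proj₁ q) ⊓ h (proj₂ q)) p) (⊓-comm (h y) (h x))
      below : ∀ {x y} → Adj G x y → h y ≤ h x → h y ≡ h x ∸ 1
      below {x} {y} x~y hy≤hx with 0 <? h x
      ... | yes hx>0 = cong (_∸ 1) (proj₂ (child-of-edge x~y hy≤hx hx>0))
      ... | no hx≯0  = trans (n≤0⇒n≡0 (≤-trans hy≤hx (≮⇒≥ hx≯0))) (cong (_∸ 1) (sym (n≤0⇒n≡0 (≮⇒≥ hx≯0))))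

    child-end-fibre : ∀ {x} → 0 < h x → ∑[ e < k G ] δ (child-end e) x ≡ 1
    child-end-fibre {x} hx>0 = trans (∑-support _ pe only-pe) (trans (cong (λ z → δ z x) child-end-pe) (δ-refl x))
      where
      pe : Fin (k G)
      pe = proj₁ (parent-adj hx>0)
      pe-joins : Joins G pe x (parent x)
      pe-joins = proj₂ (parent-adj hx>0)

      child-end-pe : child-end pe ≡ x
      child-end-pe with child-end-joins pe
      ... | y , J , hy≤ with same-ends {G} J pe-joins
      ...   | inj₁ (child-end≡x , _)      = child-end≡x
      ...   | inj₂ (child-end≡p , y≡x) = contradiction
                (≤-trans (≤-reflexive (parent-height hx>0)) (subst₂ _≤_ (cong h y≡x) (cong h child-end≡p) hy≤)) 1+n≰n

      only-pe : ∀ e → e ≢ pe → δ (child-end e) x ≡ 0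
      only-pe e e≢pe = δ-≢ (e≢pe ∘ child-end≡x⇒pe e)
        where
        child-end≡x⇒pe : ∀ e → child-end e ≡ x → e ≡ pe
        child-end≡x⇒pe e child-end≡x with child-end-joins e
        ... | y , J , hy≤ = joins-unique simple (subst₂ (Joins G e) child-end≡x y≡parent J) pe-joins
          where
          y≡parent : y ≡ parent x
          y≡parent = sym (proj₁ (subst (λ z → ChildOf z y) child-end≡x
                       (child-of-edge (e , J) hy≤ (subst (λ z → 0 < h z) (sym child-end≡x) hx>0))))

    ∑-child-end : (w : V → ℕ) → (∀ x → h x ≡ 0 → w x ≡ 0) → ∑[ e < k G ] w (child-end e) ≡ ∑[ x < n G ] w x
    ∑-child-end w w-roots = trans (∑-fibres child-end w) (sum-cong-≗ fibre*w≡w)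
      where
      fibre*w≡w : ∀ x → (∑[ e < k G ] δ (child-end e) x) * w x ≡ w x
      fibre*w≡w x with h x ≟ 0
      ... | yes hx≡0 = trans (cong (∑[ e < k G ] δ (child-end e) x *_) (w-roots x hx≡0))
                         (trans (*-zeroʳ (∑[ e < k G ] δ (child-end e) x)) (sym (w-roots x hx≡0)))
      ... | no hx≢0  = trans (cong (_* w x) (child-end-fibre (n≢0⇒n>0 hx≢0))) (*-identityˡ (w x))

    -- 1 ⊓ h x is the indicator of the non-roots.
    ∑-min-heights+non-roots :
      ∑[ e < k G ] (h (src e) ⊓ h (tgt e)) + ∑[ x < n G ] (1 ⊓ h x) ≡ ∑[ x < n G ] h x
    ∑-min-heights+non-roots = begin
        ∑[ e < k G ] (h (src e) ⊓ h (tgt e)) + ∑[ x < n G ] (1 ⊓ h x)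
      ≡⟨ cong (_+ ∑[ x < n G ] (1 ⊓ h x)) (sum-cong-≗ min-height) ⟩
        ∑[ e < k G ] (h (child-end e) ∸ 1) + ∑[ x < n G ] (1 ⊓ h x)
      ≡⟨ cong (_+ ∑[ x < n G ] (1 ⊓ h x)) (∑-child-end (λ x → h x ∸ 1) (λ x hx≡0 → cong (_∸ 1) hx≡0)) ⟩
        ∑[ x < n G ] (h x ∸ 1) + ∑[ x < n G ] (1 ⊓ h x)
      ≡⟨ ∑-distrib-+ (λ x → h x ∸ 1) (λ x → 1 ⊓ h x) ⟨
        ∑[ x < n G ] ((h x ∸ 1) + (1 ⊓ h x))
      ≡⟨ sum-cong-≗ (λ x → pred+⊓1 (h x)) ⟩
        ∑[ x < n G ] h x ∎
      where
      open ≡-Reasoning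
      pred+⊓1 : ∀ m → (m ∸ 1) + (1 ⊓ m) ≡ m
      pred+⊓1 zero    = refl
      pred+⊓1 (suc m) = +-comm m 1

    edge-count : (∀ e → 0 < h (src e) ⊎ 0 < h (tgt e)) → k G ≡ ∑[ x < n G ] (1 ⊓ h x)
    edge-count no-root-edge = begin
        k G                            ≡⟨ trans (∑-const (k G) 1) (*-identityʳ (k G)) ⟨
        ∑[ e < k G ] 1                  ≡⟨ sum-cong-≗ child-end-non-root ⟨
        ∑[ e < k G ] (1 ⊓ h (child-end e))  ≡⟨ ∑-child-end (λ x → 1 ⊓ h x) (λ x hx≡0 → cong (1 ⊓_) hx≡0) ⟩
        ∑[ x < n G ] (1 ⊓ h x)          ∎
      where
      open ≡-Reasoning
      child-end-non-root : ∀ e → 1 ⊓ h (child-end e) ≡ 1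
      child-end-non-root e = m≤n⇒m⊓n≡m
        ([ (λ p → <-≤-trans p (proj₁ (child-end-max e))) , (λ p → <-≤-trans p (proj₂ (child-end-max e))) ]′
           (no-root-edge e))

  -- Distance sums in a tree

  non-root+root : ∀ a → (1 ⊓ a) + (1 ∸ a) ≡ 1
  non-root+root zero          = refl
  non-root+root (suc zero)    = refl
  non-root+root (suc (suc a)) = refl

  non-root+roots : ∀ a b → (a ≡ 0 → b ≢ 0) → (1 ⊓ (a ⊓ b)) + ((1 ∸ a) + (1 ∸ b)) ≡ 1
  non-root+roots zero    zero    not-both = contradiction refl (not-both refl)
  non-root+roots zero    (suc b) _ = cong suc (0∸n≡0 b)
  non-root+roots (suc a) zero    _ = cong (λ z → z + 1) (0∸n≡0 a)
  non-root+roots (suc a) (suc b) _ = cong suc (cong₂ _+_ (0∸n≡0 a) (0∸n≡0 b))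

  module DistancesInTree (T : Graph) (tree : IsTree T) (d : DistFun T) (d-is-distance : IsDistance T d) where

    open ShortestPaths T d d-is-distance public

    private
      V : Set
      V = Fin (n T)
      simple : IsSimple T
      simple = proj₁ (proj₂ tree)
      acyclic : Acyclic T
      acyclic = proj₂ (proj₂ (proj₂ tree))

      src tgt : Fin (k T) → V
      src e = proj₁ (ends T e)
      tgt e = proj₂ (ends T e)

      no-loop : ∀ e → src e ≢ tgt e
      no-loop = proj₁ simple

    module RootedAt (v : V) = Layering simple acyclic (λ x → d x v) (d-lipschitz v) (λ x → geodesic-step x v)
      (λ x≡v y≡v x≢y → contradiction (trans (d≡0⇒≡ x≡v) (sym (d≡0⇒≡ y≡v))) x≢y)

    single-root : ∀ v → ∑[ x < n T ] (1 ∸ d x v) ≡ 1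
    single-root v = trans (∑-support _ v (λ x x≢v → m≤n⇒m∸n≡0 (n≢0⇒n>0 (x≢v ∘ d≡0⇒≡)))) (cong (1 ∸_) (d-refl v))

    edge-count-at : ∀ v → k T ≡ ∑[ x < n T ] (1 ⊓ d x v)
    edge-count-at v = RootedAt.edge-count v non-root-end
      where
      non-root-end : ∀ e → 0 < d (src e) v ⊎ 0 < d (tgt e) v
      non-root-end e with d (src e) v ≟ 0
      ... | no ≢0  = inj₁ (n≢0⇒n>0 ≢0)
      ... | yes ≡0 = inj₂ (n≢0⇒n>0 λ ≡0′ → no-loop e (trans (d≡0⇒≡ ≡0) (sym (d≡0⇒≡ ≡0′))))

    tree-edge-count : k T + 1 ≡ n T
    tree-edge-count = begin
        k T + 1                                          ≡⟨ cong₂ _+_ (sym (edge-count-at v)) (single-root v) ⟨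
        ∑[ x < n T ] (1 ⊓ d x v) + ∑[ x < n T ] (1 ∸ d x v) ≡⟨ ∑-distrib-+ (λ x → 1 ⊓ d x v) (λ x → 1 ∸ d x v) ⟨
        ∑[ x < n T ] ((1 ⊓ d x v) + (1 ∸ d x v))          ≡⟨ sum-cong-≗ (λ x → non-root+root (d x v)) ⟩
        ∑[ x < n T ] 1                                   ≡⟨ trans (∑-const (n T) 1) (*-identityʳ (n T)) ⟩
        n T                                              ∎
      where
      open ≡-Reasoning
      v : V
      v = fromℕ< (proj₁ tree)

    vertex-distance-sum : ∀ v → ∑[ e < k T ] (d (src e) v ⊓ d (tgt e) v) + k T ≡ ∑[ x < n T ] d x v
    vertex-distance-sum v =
      trans (cong (∑[ e < k T ] (d (src e) v ⊓ d (tgt e) v) +_) (edge-count-at v)) (RootedAt.∑-min-heights+non-roots v)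

    ∑∑-distance : ∑[ u < n T ] ∑[ v < n T ] d u v ≡ 2 * GeodesicDistance T d
    ∑∑-distance = ∑∑≡2*pairSum d d-sym d-refl

    edge-distance : Fin (k T) → V → ℕ
    edge-distance f x = d x (src f) ⊓ d x (tgt f)

    private
      edge-descent : ∀ f x → 0 < edge-distance f x →
        Σ V λ y → Adj T x y × edge-distance f y < edge-distance f x
      edge-descent f x H>0 with ≤-total (d x (src f)) (d x (tgt f))
      ... | inj₁ s≤t =
        let (y , x~y , lt) = geodesic-step x (src f) (<-≤-trans H>0 (m⊓n≤m _ _)) in
        y , x~y , ≤-<-trans (m⊓n≤m _ _) (<-≤-trans lt (≤-reflexive (sym (m≤n⇒m⊓n≡m s≤t))))
      ... | inj₂ t≤s =
        let (y , x~y , lt) = geodesic-step x (tgt f) (<-≤-trans H>0 (m⊓n≤n _ _)) in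
        y , x~y , ≤-<-trans (m⊓n≤n _ _) (<-≤-trans lt (≤-reflexive (sym (m≥n⇒m⊓n≡n t≤s))))

      root-end : ∀ f {x} → edge-distance f x ≡ 0 → x ≡ src f ⊎ x ≡ tgt f
      root-end f {x} H≡0 with ≤-total (d x (src f)) (d x (tgt f))
      ... | inj₁ s≤t = inj₁ (d≡0⇒≡ (trans (sym (m≤n⇒m⊓n≡m s≤t)) H≡0))
      ... | inj₂ t≤s = inj₂ (d≡0⇒≡ (trans (sym (m≥n⇒m⊓n≡n t≤s)) H≡0))

      edge-roots-adjacent : ∀ f {x y} → edge-distance f x ≡ 0 → edge-distance f y ≡ 0 → x ≢ y → Adj T x y
      edge-roots-adjacent f Hx≡0 Hy≡0 x≢y with root-end f Hx≡0 | root-end f Hy≡0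
      ... | inj₁ refl | inj₁ refl = contradiction refl x≢y
      ... | inj₁ refl | inj₂ refl = f , inj₁ refl
      ... | inj₂ refl | inj₁ refl = f , inj₂ refl
      ... | inj₂ refl | inj₂ refl = contradiction refl x≢y

    edge-distance-lipschitz : ∀ f {x y} → Adj T x y → edge-distance f x ≤ suc (edge-distance f y)
    edge-distance-lipschitz f x~y = ⊓-mono-≤ (d-lipschitz (src f) x~y) (d-lipschitz (tgt f) x~y)

    edge-distance-src : ∀ f → edge-distance f (src f) ≡ 0
    edge-distance-src f = cong (_⊓ d (src f) (tgt f)) (d-refl (src f))

    edge-distance-tgt : ∀ f → edge-distance f (tgt f) ≡ 0
    edge-distance-tgt f = trans (cong (d (tgt f) (src f) ⊓_) (d-refl (tgt f))) (⊓-zeroʳ _)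

    module RootedAtEdge (f : Fin (k T)) =
      Layering simple acyclic (edge-distance f) (edge-distance-lipschitz f) (edge-descent f) (edge-roots-adjacent f)

    edge-non-roots : ∀ f → ∑[ x < n T ] (1 ⊓ edge-distance f x) + 2 ≡ n T
    edge-non-roots f = begin
        ∑[ x < n T ] (1 ⊓ H x) + 2
      ≡⟨ cong (∑[ x < n T ] (1 ⊓ H x) +_) (cong₂ _+_ (single-root (src f)) (single-root (tgt f))) ⟨
        ∑[ x < n T ] (1 ⊓ H x) + (∑[ x < n T ] (1 ∸ d x (src f)) + ∑[ x < n T ] (1 ∸ d x (tgt f)))
      ≡⟨ cong (∑[ x < n T ] (1 ⊓ H x) +_) (∑-distrib-+ (λ x → 1 ∸ d x (src f)) (λ x → 1 ∸ d x (tgt f))) ⟨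
        ∑[ x < n T ] (1 ⊓ H x) + ∑[ x < n T ] ((1 ∸ d x (src f)) + (1 ∸ d x (tgt f)))
      ≡⟨ ∑-distrib-+ (λ x → 1 ⊓ H x) (λ x → (1 ∸ d x (src f)) + (1 ∸ d x (tgt f))) ⟨
        ∑[ x < n T ] ((1 ⊓ H x) + ((1 ∸ d x (src f)) + (1 ∸ d x (tgt f))))
      ≡⟨ sum-cong-≗ (λ x → non-root+roots (d x (src f)) (d x (tgt f))
                      (λ ≡0 ≡0′ → no-loop f (trans (sym (d≡0⇒≡ ≡0)) (d≡0⇒≡ ≡0′)))) ⟩
        ∑[ x < n T ] 1
      ≡⟨ trans (∑-const (n T) 1) (*-identityʳ (n T)) ⟩
        n T ∎
      where
      open ≡-Reasoning
      H : V → ℕ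
      H = edge-distance f

    edge-distance-sum : ∀ f →
      ∑[ e < k T ] (edge-distance f (src e) ⊓ edge-distance f (tgt e)) + n T ≡ ∑[ x < n T ] edge-distance f x + 2
    edge-distance-sum f = begin
        ∑[ e < k T ] (H (src e) ⊓ H (tgt e)) + n T
      ≡⟨ cong (∑[ e < k T ] (H (src e) ⊓ H (tgt e)) +_) (edge-non-roots f) ⟨
        ∑[ e < k T ] (H (src e) ⊓ H (tgt e)) + (∑[ x < n T ] (1 ⊓ H x) + 2)
      ≡⟨ +-assoc (∑[ e < k T ] (H (src e) ⊓ H (tgt e))) (∑[ x < n T ] (1 ⊓ H x)) 2 ⟨
        ∑[ e < k T ] (H (src e) ⊓ H (tgt e)) + ∑[ x < n T ] (1 ⊓ H x) + 2
      ≡⟨ cong (_+ 2) (RootedAtEdge.∑-min-heights+non-roots f) ⟩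
        ∑[ x < n T ] H x + 2 ∎
      where
      open ≡-Reasoning
      H : V → ℕ
      H = edge-distance f

    ∑∑-edge-distance : ∑[ f < k T ] ∑[ x < n T ] edge-distance f x + n T * k T ≡ 2 * GeodesicDistance T d
    ∑∑-edge-distance = begin
        ∑[ f < k T ] ∑[ x < n T ] edge-distance f x + n T * k T
      ≡⟨ cong₂ _+_ (sym (∑-comm (λ f x → edge-distance f x))) (∑-const (n T) (k T)) ⟨
        ∑[ x < n T ] ∑[ f < k T ] edge-distance f x + ∑[ x < n T ] k T
      ≡⟨ ∑-distrib-+ (λ x → ∑[ f < k T ] edge-distance f x) (λ _ → k T) ⟨
        ∑[ x < n T ] (∑[ f < k T ] edge-distance f x + k T)
      ≡⟨ sum-cong-≗ (λ x → trans (cong (_+ k T) (sum-cong-≗ (λ f → cong₂ _⊓_ (d-sym x (src f)) (d-sym x (tgt f)))))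
                                  (vertex-distance-sum x)) ⟩
        ∑[ x < n T ] ∑[ u < n T ] d u x
      ≡⟨ ∑-comm d ⟨
        ∑[ u < n T ] ∑[ x < n T ] d u x
      ≡⟨ ∑∑-distance ⟩
        2 * GeodesicDistance T d ∎
      where open ≡-Reasoning

  -- The star-fractal graph

  module StarFractal (m : ℕ) (T : Graph) where

    G⋆ : Graph
    G⋆ = starFractal m T

    private
      V E V⋆ : Set
      V = Fin (n T)
      E = Fin (k T)
      V⋆ = Fin (n G⋆)

      src tgt : E → V
      src e = proj₁ (ends T e)
      tgt e = proj₂ (ends T e)

    old : V → V⋆
    old u = u ↑ˡ (k T + k T * m)

    mid : E → V⋆
    mid e = n T ↑ʳ (e ↑ˡ (k T * m))

    pend : E → Fin m → V⋆
    pend e t = n T ↑ʳ (k T ↑ʳ combine e t)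

    vertex-elim : (P : V⋆ → Set) → (∀ u → P (old u)) → (∀ e → P (mid e)) → (∀ e t → P (pend e t)) →
      ∀ x → P x
    vertex-elim P P-old P-mid P-pend x with splitAt (n T) x in x≡
    ... | inj₁ u = subst P (Finₚ.splitAt⁻¹-↑ˡ x≡) (P-old u)
    ... | inj₂ r with splitAt (k T) r in r≡
    ...   | inj₁ e = subst P (trans (cong (n T ↑ʳ_) (Finₚ.splitAt⁻¹-↑ˡ r≡)) (Finₚ.splitAt⁻¹-↑ʳ x≡)) (P-mid e)
    ...   | inj₂ p = subst P (trans (cong (λ z → n T ↑ʳ (k T ↑ʳ z)) (Finₚ.combine-remQuot {k T} m p))
                                (trans (cong (n T ↑ʳ_) (Finₚ.splitAt⁻¹-↑ʳ r≡)) (Finₚ.splitAt⁻¹-↑ʳ x≡)))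
                       (P-pend (proj₁ (remQuot {k T} m p)) (proj₂ (remQuot {k T} m p)))

    ∑-vertices : ∀ (F : V⋆ → ℕ) → ∑[ x < n G⋆ ] F x
      ≡ ∑[ u < n T ] F (old u) + (∑[ e < k T ] F (mid e) + ∑[ e < k T ] ∑[ t < m ] F (pend e t))
    ∑-vertices F = trans (∑-++ (n T) (k T + k T * m) F) (cong (∑[ u < n T ] F (old u) +_)
      (trans (∑-++ (k T) (k T * m) (λ r → F (n T ↑ʳ r))) (cong (∑[ e < k T ] F (mid e) +_) (∑-combine (k T) m _))))

    old≢pend : ∀ {u e t} → old u ≢ pend e t
    old≢pend {u} {e} {t} eq
      with trans (sym (Finₚ.splitAt-↑ˡ (n T) u (k T + k T * m)))
                 (trans (cong (splitAt (n T)) eq) (Finₚ.splitAt-↑ʳ (n T) (k T + k T * m) (k T ↑ʳ combine e t)))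
    ... | ()

    mid≢pend : ∀ {e f t} → mid e ≢ pend f t
    mid≢pend {e} {f} {t} eq
      with trans (sym (Finₚ.splitAt-↑ˡ (k T) e (k T * m)))
                 (trans (cong (splitAt (k T)) (Finₚ.↑ʳ-injective (n T) _ _ eq))
                        (Finₚ.splitAt-↑ʳ (k T) (k T * m) (combine f t)))
    ... | ()

    pend-injective : ∀ {e f t s} → pend e t ≡ pend f s → e ≡ f
    pend-injective {e} {f} {t} {s} eq =
      Finₚ.combine-injectiveˡ e t f s (Finₚ.↑ʳ-injective (k T) _ _ (Finₚ.↑ʳ-injective (n T) _ _ eq))

    data EdgeShape : V⋆ × V⋆ → Set where
      src-edge     : ∀ e → EdgeShape (old (src e) , mid e)
      tgt-edge     : ∀ e → EdgeShape (mid e , old (tgt e))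
      pendant-edge : ∀ e t → EdgeShape (mid e , pend e t)

    edge-shape : ∀ e′ → EdgeShape (ends G⋆ e′)
    edge-shape e′ with remQuot {k T} (suc (suc m)) e′
    ... | e , zero          = src-edge e
    ... | e , suc zero      = tgt-edge e
    ... | e , suc (suc t)   = pendant-edge e t

    old-mid : ∀ e → Adj G⋆ (old (src e)) (mid e)
    old-mid e = combine e zero , inj₁ ends≡
      where
      ends≡ : ends G⋆ (combine e zero) ≡ (old (src e) , mid e)
      ends≡ rewrite Finₚ.remQuot-combine {k T} {suc (suc m)} e zero = refl

    mid-old : ∀ e → Adj G⋆ (mid e) (old (tgt e))
    mid-old e = combine e (suc zero) , inj₁ ends≡
      where
      ends≡ : ends G⋆ (combine e (suc zero)) ≡ (mid e , old (tgt e))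
      ends≡ rewrite Finₚ.remQuot-combine {k T} {suc (suc m)} e (suc zero) = refl

    mid-pend : ∀ e t → Adj G⋆ (mid e) (pend e t)
    mid-pend e t = combine e (suc (suc t)) , inj₁ ends≡
      where
      ends≡ : ends G⋆ (combine e (suc (suc t))) ≡ (mid e , pend e t)
      ends≡ rewrite Finₚ.remQuot-combine {k T} {suc (suc m)} e (suc (suc t)) = refl

    pendant-neighbour : ∀ {x e t} → Adj G⋆ x (pend e t) → x ≡ mid e
    pendant-neighbour {x} {e} {t} (e′ , x~p) = from-shape (edge-shape e′) x~p
      where
      from-shape : ∀ {q} → EdgeShape q → (q ≡ (x , pend e t)) ⊎ (q ≡ (pend e t , x)) → x ≡ mid e
      from-shape (src-edge _)       (inj₁ q≡) = contradiction (proj₂ (,-injective q≡)) mid≢pend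
      from-shape (src-edge _)       (inj₂ q≡) = contradiction (proj₁ (,-injective q≡)) old≢pend
      from-shape (tgt-edge _)       (inj₁ q≡) = contradiction (proj₂ (,-injective q≡)) old≢pend
      from-shape (tgt-edge _)       (inj₂ q≡) = contradiction (proj₁ (,-injective q≡)) mid≢pend
      from-shape (pendant-edge f s) (inj₁ q≡) =
        let (mid≡x , pend≡pend) = ,-injective q≡ in trans (sym mid≡x) (cong mid (pend-injective pend≡pend))
      from-shape (pendant-edge _ _) (inj₂ q≡) = contradiction (proj₁ (,-injective q≡)) mid≢pend

    lift-adj : ∀ {a b} → Adj T a b → Walk G⋆ (old a) (old b) 2
    lift-adj (e , inj₁ p) = subst₂ (λ a b → Walk G⋆ (old a) (old b) 2) (cong proj₁ p) (cong proj₂ p)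
                              (step (old-mid e) (step (mid-old e) here))
    lift-adj (e , inj₂ p) = subst₂ (λ a b → Walk G⋆ (old a) (old b) 2) (cong proj₂ p) (cong proj₁ p)
                              (step (adj-sym (mid-old e)) (step (adj-sym (old-mid e)) here))

    lift : ∀ {a b l} → Walk T a b l → Walk G⋆ (old a) (old b) (2 * l)
    lift here = here
    lift {l = suc l} (step a~b p) = subst (Walk G⋆ _ _) (sym (*-suc 2 l)) (lift-adj a~b ++ʷ lift p)

    -- fO on the old vertices, fM on the subdivision vertices, and 1 + fM e on the pendants at e.
    potential : (V → ℕ) → (E → ℕ) → V⋆ → ℕ
    potential fO fM x =
      [ fO , (λ r → [ fM , (λ p → suc (fM (proj₁ (remQuot {k T} m p)))) ]′ (splitAt (k T) r)) ]′ (splitAt (n T) x)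

    module _ (fO : V → ℕ) (fM : E → ℕ) where

      potential-old : ∀ u → potential fO fM (old u) ≡ fO u
      potential-old u rewrite Finₚ.splitAt-↑ˡ (n T) u (k T + k T * m) = refl

      potential-mid : ∀ e → potential fO fM (mid e) ≡ fM e
      potential-mid e rewrite Finₚ.splitAt-↑ʳ (n T) (k T + k T * m) (e ↑ˡ (k T * m))
                            | Finₚ.splitAt-↑ˡ (k T) e (k T * m) = refl

      potential-pend : ∀ e t → potential fO fM (pend e t) ≡ suc (fM e)
      potential-pend e t rewrite Finₚ.splitAt-↑ʳ (n T) (k T + k T * m) (k T ↑ʳ combine e t)
                               | Finₚ.splitAt-↑ʳ (k T) (k T * m) (combine e t)
        = cong (λ q → suc (fM (proj₁ q))) (Finₚ.remQuot-combine {k T} {m} e t)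

      potential-lipschitz : (∀ e → Close (fO (src e)) (fM e) × Close (fM e) (fO (tgt e))) →
        ∀ {x y} → Adj G⋆ x y → potential fO fM x ≤ suc (potential fO fM y)
      potential-lipschitz close = lipschitz-from-edges F (λ e′ → shape-close (edge-shape e′))
        where
        F : V⋆ → ℕ
        F = potential fO fM
        shape-close : ∀ {q} → EdgeShape q → Close (F (proj₁ q)) (F (proj₂ q))
        shape-close (src-edge e)       =
          subst₂ Close (sym (potential-old (src e))) (sym (potential-mid e)) (proj₁ (close e))
        shape-close (tgt-edge e)       =
          subst₂ Close (sym (potential-mid e)) (sym (potential-old (tgt e))) (proj₂ (close e))
        shape-close (pendant-edge e t) =
          subst₂ Close (sym (potential-mid e)) (sym (potential-pend e t)) (≤-trans (n≤1+n _) (n≤1+n _) , ≤-refl)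

    module Columns (d⋆ : DistFun G⋆) (d⋆-is-distance : IsDistance G⋆ d⋆) where

      open ShortestPaths G⋆ d⋆ d⋆-is-distance

      column-sum : ∀ {y} (fO : V → ℕ) (fM : E → ℕ) →
        (∀ e → Close (fO (src e)) (fM e) × Close (fM e) (fO (tgt e))) → potential fO fM y ≡ 0 →
        (∀ u → Walk G⋆ (old u) y (fO u)) → (∀ e → Walk G⋆ (mid e) y (fM e)) →
        ∑[ x < n G⋆ ] d⋆ x y ≡ ∑[ u < n T ] fO u + (k T * m + (1 + m) * ∑[ e < k T ] fM e)
      column-sum {y} fO fM close F-y old-walk mid-walk = begin
          ∑[ x < n G⋆ ] d⋆ x y
        ≡⟨ sum-cong-≗ (potential-is-distance F (potential-lipschitz fO fM close) F-y walk) ⟩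
          ∑[ x < n G⋆ ] F x
        ≡⟨ ∑-vertices F ⟩
          ∑[ u < n T ] F (old u) + (∑[ e < k T ] F (mid e) + ∑[ e < k T ] ∑[ t < m ] F (pend e t))
        ≡⟨ cong₂ _+_ (sum-cong-≗ (potential-old fO fM))
                     (trans (sym (∑-distrib-+ (F ∘ mid) (λ e → ∑[ t < m ] F (pend e t)))) (sum-cong-≗ per-edge)) ⟩
          ∑[ u < n T ] fO u + ∑[ e < k T ] (m + (1 + m) * fM e)
        ≡⟨ cong (∑[ u < n T ] fO u +_) (∑-affine m (1 + m) fM) ⟩
          ∑[ u < n T ] fO u + (k T * m + (1 + m) * ∑[ e < k T ] fM e) ∎
        where
        open ≡-Reasoning
        F : V⋆ → ℕ
        F = potential fO fM

        walk : ∀ x → Walk G⋆ x y (F x)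
        walk = vertex-elim (λ x → Walk G⋆ x y (F x))
          (λ u → subst (Walk G⋆ _ y) (sym (potential-old fO fM u)) (old-walk u))
          (λ e → subst (Walk G⋆ _ y) (sym (potential-mid fO fM e)) (mid-walk e))
          (λ e t → subst (Walk G⋆ _ y) (sym (potential-pend fO fM e t)) (step (adj-sym (mid-pend e t)) (mid-walk e)))

        per-edge : ∀ e → F (mid e) + ∑[ t < m ] F (pend e t) ≡ m + (1 + m) * fM e
        per-edge e = begin
            F (mid e) + ∑[ t < m ] F (pend e t)
          ≡⟨ cong₂ _+_ (potential-mid fO fM e) (trans (sum-cong-≗ (potential-pend fO fM e)) (∑-const m (suc (fM e)))) ⟩
            fM e + m * suc (fM e)
          ≡⟨ regroup (fM e) m ⟩
            m + (1 + m) * fM e ∎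
          where
          regroup : ∀ a m → a + m * suc a ≡ m + (1 + m) * a
          regroup = solve-∀

      column-pend : ∀ e t → ∑[ x < n G⋆ ] d⋆ x (pend e t) + 2 ≡ n G⋆ + ∑[ x < n G⋆ ] d⋆ x (mid e)
      column-pend e t = begin
          ∑[ x < n G⋆ ] d⋆ x y + 2
        ≡⟨ cong (λ z → ∑[ x < n G⋆ ] d⋆ x y + suc z) y-to-mid ⟨
          ∑[ x < n G⋆ ] d⋆ x y + suc (d⋆ y (mid e))
        ≡⟨ ∑-agree-except (λ x → d⋆ x y) (λ x → suc (d⋆ x (mid e))) y
             (λ x x≢y → distance-to-leaf (mid-pend e t) pendant-neighbour x≢y) ⟩
          ∑[ x < n G⋆ ] suc (d⋆ x (mid e)) + d⋆ y y
        ≡⟨ cong₂ _+_ (∑-distrib-+ (λ _ → 1) (λ x → d⋆ x (mid e))) (d-refl y) ⟩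
          ∑[ x < n G⋆ ] 1 + ∑[ x < n G⋆ ] d⋆ x (mid e) + 0
        ≡⟨ +-identityʳ _ ⟩
          ∑[ x < n G⋆ ] 1 + ∑[ x < n G⋆ ] d⋆ x (mid e)
        ≡⟨ cong (_+ ∑[ x < n G⋆ ] d⋆ x (mid e)) (trans (∑-const (n G⋆) 1) (*-identityʳ (n G⋆))) ⟩
          n G⋆ + ∑[ x < n G⋆ ] d⋆ x (mid e) ∎
        where
        open ≡-Reasoning
        y : Fin (n G⋆)
        y = pend e t
        y-to-mid : d⋆ y (mid e) ≡ 1
        y-to-mid = trans (d-sym y (mid e))
          (trans (distance-to-leaf (mid-pend e t) pendant-neighbour mid≢pend) (cong suc (d-refl (mid e))))

  -- Distance sums in the star-fractal tree

  module StarOfTree (m : ℕ) (T : Graph) (tree : IsTree T) (d : DistFun T) (d-is-distance : IsDistance T d)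
    (d⋆ : DistFun (starFractal m T)) (d⋆-is-distance : IsDistance (starFractal m T) d⋆) where

    open DistancesInTree T tree d d-is-distance
    open StarFractal m T
    open Columns d⋆ d⋆-is-distance

    private
      module D⋆ = ShortestPaths G⋆ d⋆ d⋆-is-distance

      V E : Set
      V = Fin (n T)
      E = Fin (k T)

      src tgt : E → V
      src e = proj₁ (ends T e)
      tgt e = proj₂ (ends T e)

      edge-adj : ∀ e → Adj T (src e) (tgt e)
      edge-adj e = e , inj₁ refl

    column : Fin (n G⋆) → ℕ
    column y = ∑[ x < n G⋆ ] d⋆ x y

    column-old : ∀ v → column (old v) + k T ≡ 2 * (m + 2) * ∑[ u < n T ] d u v
    column-old v = begin
        column (old v) + k T
      ≡⟨ cong (_+ k T) (column-sum fO fM close F-v old-walk mid-walk) ⟩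
        ∑[ u < n T ] (2 * d u v) + (k T * m + (1 + m) * ∑[ e < k T ] (1 + 2 * M e)) + k T
      ≡⟨ cong₂ (λ a b → a + (k T * m + (1 + m) * b) + k T) (∑-*ˡ 2 (λ u → d u v)) (∑-affine 1 2 M) ⟩
        2 * D + (k T * m + (1 + m) * (k T * 1 + 2 * ∑[ e < k T ] M e)) + k T
      ≡⟨ regroup D (∑[ e < k T ] M e) (k T) m ⟩
        2 * D + 2 * (1 + m) * (∑[ e < k T ] M e + k T)
      ≡⟨ cong (λ z → 2 * D + 2 * (1 + m) * z) (vertex-distance-sum v) ⟩
        2 * D + 2 * (1 + m) * D
      ≡⟨ collect D m ⟩
        2 * (m + 2) * D ∎
      where
      open ≡-Reasoning
      D : ℕ
      D = ∑[ u < n T ] d u v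
      M : E → ℕ
      M e = d (src e) v ⊓ d (tgt e) v
      fO : V → ℕ
      fO u = 2 * d u v
      fM : E → ℕ
      fM e = 1 + 2 * M e
      close : ∀ e → Close (fO (src e)) (fM e) × Close (fM e) (fO (tgt e))
      close e = close-min (d-lipschitz v (edge-adj e)) (d-lipschitz v (adj-sym (edge-adj e)))
      F-v : potential fO fM (old v) ≡ 0
      F-v = trans (potential-old fO fM v) (cong (2 *_) (d-refl v))
      old-walk : ∀ u → Walk G⋆ (old u) (old v) (fO u)
      old-walk u = lift (geodesic u v)
      mid-walk : ∀ e → Walk G⋆ (mid e) (old v) (fM e)
      mid-walk e = subst (Walk G⋆ (mid e) (old v)) (cong suc (sym (*-distribˡ-⊓ 2 (d (src e) v) (d (tgt e) v))))
        (walk-⊓ (step (adj-sym (old-mid e)) (lift (geodesic (src e) v)))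
                (step (mid-old e) (lift (geodesic (tgt e) v))))
      regroup : ∀ D A K m → 2 * D + (K * m + (1 + m) * (K * 1 + 2 * A)) + K ≡ 2 * D + 2 * (1 + m) * (A + K)
      regroup = solve-∀
      collect : ∀ D m → 2 * D + 2 * (1 + m) * D ≡ 2 * (m + 2) * D
      collect = solve-∀

    mid-potential : E → E → ℕ
    mid-potential f e with e Finₚ.≟ f
    ... | yes _ = 0
    ... | no _  = 2 + 2 * (edge-distance f (src e) ⊓ edge-distance f (tgt e))

    mid-potential-self : ∀ f → mid-potential f f ≡ 0
    mid-potential-self f with f Finₚ.≟ f
    ... | yes _  = refl
    ... | no f≢f = contradiction refl f≢f

    ∑-mid-potential : ∀ f → ∑[ e < k T ] mid-potential f e ≡ 2 * ∑[ x < n T ] edge-distance f x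
    ∑-mid-potential f = eliminate (∑[ e < k T ] mid-potential f e) (k T) B _ (n T)
                          ∑-mid-potential+2 (edge-distance-sum f) tree-edge-count
      where
      open ≡-Reasoning
      H : V → ℕ
      H = edge-distance f
      B : ℕ
      B = ∑[ e < k T ] (H (src e) ⊓ H (tgt e))

      g : E → ℕ
      g e = 2 + 2 * (H (src e) ⊓ H (tgt e))

      agree : ∀ e → e ≢ f → mid-potential f e ≡ g e
      agree e e≢f with e Finₚ.≟ f
      ... | yes e≡f = contradiction e≡f e≢f
      ... | no _    = refl

      ∑-mid-potential+2 : ∑[ e < k T ] mid-potential f e + 2 ≡ k T * 2 + 2 * B
      ∑-mid-potential+2 = begin
          ∑[ e < k T ] mid-potential f e + 2
        ≡⟨ cong (λ z → ∑[ e < k T ] mid-potential f e + (2 + 2 * (z ⊓ H (tgt f)))) (edge-distance-src f) ⟨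
          ∑[ e < k T ] mid-potential f e + g f
        ≡⟨ ∑-agree-except (mid-potential f) g f agree ⟩
          ∑[ e < k T ] g e + mid-potential f f
        ≡⟨ cong₂ _+_ (∑-affine 2 2 (λ e → H (src e) ⊓ H (tgt e))) (mid-potential-self f) ⟩
          k T * 2 + 2 * B + 0
        ≡⟨ +-identityʳ _ ⟩
          k T * 2 + 2 * B ∎

      eliminate : ∀ X K B S N → X + 2 ≡ K * 2 + 2 * B → B + N ≡ S + 2 → K + 1 ≡ N → X ≡ 2 * S
      eliminate X K B S _ X+2≡ B+N≡ refl = +-cancelʳ-≡ (2 * K + 4) X (2 * S) (begin
          X + (2 * K + 4)              ≡⟨ r₁ X K ⟩
          X + 2 + 2 * (K + 1)          ≡⟨ cong (_+ 2 * (K + 1)) X+2≡ ⟩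
          K * 2 + 2 * B + 2 * (K + 1)  ≡⟨ r₂ K B ⟩
          2 * K + 2 * (B + (K + 1))    ≡⟨ cong (λ z → 2 * K + 2 * z) B+N≡ ⟩
          2 * K + 2 * (S + 2)          ≡⟨ r₃ K S ⟩
          2 * S + (2 * K + 4)          ∎)
        where
        r₁ : ∀ X K → X + (2 * K + 4) ≡ X + 2 + 2 * (K + 1)
        r₁ = solve-∀
        r₂ : ∀ K B → K * 2 + 2 * B + 2 * (K + 1) ≡ 2 * K + 2 * (B + (K + 1))
        r₂ = solve-∀
        r₃ : ∀ K S → 2 * K + 2 * (S + 2) ≡ 2 * S + (2 * K + 4)
        r₃ = solve-∀

    column-mid : ∀ f → column (mid f) ≡ (n T + k T * m) + 2 * (m + 2) * ∑[ x < n T ] edge-distance f x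
    column-mid f = begin
        column (mid f)
      ≡⟨ column-sum fO (mid-potential f) close F-f old-walk mid-walk ⟩
        ∑[ u < n T ] (1 + 2 * H u) + (k T * m + (1 + m) * ∑[ e < k T ] mid-potential f e)
      ≡⟨ cong₂ (λ a b → a + (k T * m + (1 + m) * b)) (∑-affine 1 2 H) (∑-mid-potential f) ⟩
        n T * 1 + 2 * HS + (k T * m + (1 + m) * (2 * HS))
      ≡⟨ regroup (n T) (k T) HS m ⟩
        (n T + k T * m) + 2 * (m + 2) * HS ∎
      where
      open ≡-Reasoning
      H : V → ℕ
      H = edge-distance f
      HS : ℕ
      HS = ∑[ x < n T ] H x
      fO : V → ℕ
      fO u = 1 + 2 * H u

      close : ∀ e → Close (fO (src e)) (mid-potential f e) × Close (mid-potential f e) (fO (tgt e))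
      close e with e Finₚ.≟ f
      ... | yes refl = subst₂ (λ a b → Close (1 + 2 * a) 0 × Close 0 (1 + 2 * b))
                         (sym (edge-distance-src f)) (sym (edge-distance-tgt f)) ((s≤s z≤n , z≤n) , (z≤n , s≤s z≤n))
      ... | no _     =
        let (c₁ , c₂) = close-min (edge-distance-lipschitz f (edge-adj e))
                                  (edge-distance-lipschitz f (adj-sym (edge-adj e)))
        in close-suc c₁ , close-suc c₂

      F-f : potential fO (mid-potential f) (mid f) ≡ 0
      F-f = trans (potential-mid fO (mid-potential f) f) (mid-potential-self f)

      old-walk : ∀ u → Walk G⋆ (old u) (mid f) (fO u)
      old-walk u = subst (Walk G⋆ (old u) (mid f)) (cong suc (sym (*-distribˡ-⊓ 2 (d u (src f)) (d u (tgt f)))))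
        (walk-⊓ (lift (geodesic u (src f)) ∷ʳʷ old-mid f) (lift (geodesic u (tgt f)) ∷ʳʷ adj-sym (mid-old f)))

      mid-walk : ∀ e → Walk G⋆ (mid e) (mid f) (mid-potential f e)
      mid-walk e with e Finₚ.≟ f
      ... | yes refl = here
      ... | no _     = subst (Walk G⋆ (mid e) (mid f)) (cong (2 +_) (sym (*-distribˡ-⊓ 2 (H (src e)) (H (tgt e)))))
        (walk-⊓ (step (adj-sym (old-mid e)) (old-walk (src e))) (step (mid-old e) (old-walk (tgt e))))

      regroup : ∀ N K S m → N * 1 + 2 * S + (K * m + (1 + m) * (2 * S)) ≡ (N + K * m) + 2 * (m + 2) * S
      regroup = solve-∀

    ∑-column-old : ∑[ v < n T ] column (old v) + n T * k T ≡ 2 * (m + 2) * (2 * GeodesicDistance T d)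
    ∑-column-old = begin
        ∑[ v < n T ] column (old v) + n T * k T
      ≡⟨ cong (∑[ v < n T ] column (old v) +_) (∑-const (n T) (k T)) ⟨
        ∑[ v < n T ] column (old v) + ∑[ v < n T ] k T
      ≡⟨ ∑-distrib-+ (column ∘ old) (λ _ → k T) ⟨
        ∑[ v < n T ] (column (old v) + k T)
      ≡⟨ sum-cong-≗ column-old ⟩
        ∑[ v < n T ] (2 * (m + 2) * ∑[ u < n T ] d u v)
      ≡⟨ ∑-*ˡ (2 * (m + 2)) (λ v → ∑[ u < n T ] d u v) ⟩
        2 * (m + 2) * ∑[ v < n T ] ∑[ u < n T ] d u v
      ≡⟨ cong (2 * (m + 2) *_) (trans (∑-comm (λ v u → d u v)) ∑∑-distance) ⟩
        2 * (m + 2) * (2 * GeodesicDistance T d) ∎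
      where open ≡-Reasoning

    ∑-column-mid : ∑[ f < k T ] column (mid f)
      ≡ k T * (n T + k T * m) + 2 * (m + 2) * ∑[ f < k T ] ∑[ x < n T ] edge-distance f x
    ∑-column-mid =
      trans (sum-cong-≗ column-mid) (∑-affine (n T + k T * m) (2 * (m + 2)) (λ f → ∑[ x < n T ] edge-distance f x))

    ∑-column-pend : ∑[ f < k T ] ∑[ s < m ] column (pend f s) + k T * (m * 2)
      ≡ m * (k T * n G⋆ + ∑[ f < k T ] column (mid f))
    ∑-column-pend = begin
        ∑[ f < k T ] ∑[ s < m ] column (pend f s) + k T * (m * 2)
      ≡⟨ cong (∑[ f < k T ] ∑[ s < m ] column (pend f s) +_)
           (trans (sum-cong-≗ {k T} (λ _ → ∑-const m 2)) (∑-const (k T) (m * 2))) ⟨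
        ∑[ f < k T ] ∑[ s < m ] column (pend f s) + ∑[ f < k T ] ∑[ s < m ] 2
      ≡⟨ ∑-distrib-+ (λ f → ∑[ s < m ] column (pend f s)) (λ _ → ∑[ s < m ] 2) ⟨
        ∑[ f < k T ] (∑[ s < m ] column (pend f s) + ∑[ s < m ] 2)
      ≡⟨ sum-cong-≗ (λ f → trans (sym (∑-distrib-+ (column ∘ pend f) (λ _ → 2))) (sum-cong-≗ (column-pend f))) ⟩
        ∑[ f < k T ] ∑[ s < m ] (n G⋆ + column (mid f))
      ≡⟨ sum-cong-≗ (λ f → ∑-const m (n G⋆ + column (mid f))) ⟩
        ∑[ f < k T ] (m * (n G⋆ + column (mid f)))
      ≡⟨ ∑-*ˡ m (λ f → n G⋆ + column (mid f)) ⟩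
        m * ∑[ f < k T ] (n G⋆ + column (mid f))
      ≡⟨ cong (m *_) (trans (∑-distrib-+ (λ _ → n G⋆) (column ∘ mid))
                            (cong (_+ ∑[ f < k T ] column (mid f)) (∑-const (k T) (n G⋆)))) ⟩
        m * (k T * n G⋆ + ∑[ f < k T ] column (mid f)) ∎
      where open ≡-Reasoning

    ∑-columns : 2 * GeodesicDistance G⋆ d⋆
      ≡ ∑[ v < n T ] column (old v) + (∑[ f < k T ] column (mid f) + ∑[ f < k T ] ∑[ s < m ] column (pend f s))
    ∑-columns = trans (sym (∑∑≡2*pairSum d⋆ D⋆.d-sym D⋆.d-refl)) (trans (∑-comm d⋆) (∑-vertices column))

  -- Twice the goal, with C added to both sides, is a linear combination of the hypotheses.
  star-fractal-arithmetic : ∀ m K N S A O M P S⋆ → K + 1 ≡ N →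
    2 * S⋆ ≡ O + (M + P) →
    O + N * K ≡ 2 * (m + 2) * (2 * S) →
    M ≡ K * (N + K * m) + 2 * (m + 2) * A →
    A + N * K ≡ 2 * S →
    P + K * (m * 2) ≡ m * (K * (N + (K + K * m)) + M) →
    S⋆ + (m + 2) * K * (m + N) ≡ 2 * ((m + 2) * (m + 2)) * S
  star-fractal-arithmetic m K _ S A O _ P S⋆ refl S⋆≡ O≡ refl A≡ P≡ =
    *-cancelˡ-≡ (S⋆ + R) Q 2 (+-cancelʳ-≡ C (2 * (S⋆ + R)) (2 * Q) (begin
        2 * (S⋆ + R) + C
      ≡⟨ expand S⋆ R C ⟩
        2 * S⋆ + (2 * R + C)
      ≡⟨ cong (_+ (2 * R + C)) S⋆≡ ⟩
        O + (M + P) + (2 * R + C)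
      ≡⟨ regroup O M P R a b c ⟩
        (O + a) + (P + b) + (M + 2 * R + c * a)
      ≡⟨ cong₂ (λ x y → x + y + (M + 2 * R + c * a)) O≡ P≡ ⟩
        2 * (m + 2) * (2 * S) + m * (K * n⋆ + M) + (M + 2 * R + c * a)
      ≡⟨ collect (2 * (m + 2) * (2 * S)) m (K * n⋆) (K * ((K + 1) + K * m)) A R a ⟩
        2 * (m + 2) * (2 * S) + X + c * (A + a)
      ≡⟨ cong (λ z → 2 * (m + 2) * (2 * S) + X + c * z) A≡ ⟩
        2 * (m + 2) * (2 * S) + X + c * (2 * S)
      ≡⟨ identity m K S ⟩
        2 * Q + C ∎))
    where
    open ≡-Reasoning
    a b c C M n⋆ R Q X : ℕ
    a = (K + 1) * K
    b = K * (m * 2)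
    c = (1 + m) * (2 * (m + 2))
    C = a + b + c * a
    M = K * ((K + 1) + K * m) + 2 * (m + 2) * A
    n⋆ = (K + 1) + (K + K * m)
    R = (m + 2) * K * (m + (K + 1))
    Q = 2 * ((m + 2) * (m + 2)) * S
    X = m * (K * n⋆) + (1 + m) * (K * ((K + 1) + K * m)) + 2 * R

    expand : ∀ s r c → 2 * (s + r) + c ≡ 2 * s + (2 * r + c)
    expand = solve-∀
    regroup : ∀ o M p r a b c → o + (M + p) + (2 * r + (a + b + c * a)) ≡ (o + a) + (p + b) + (M + 2 * r + c * a)
    regroup = solve-∀
    collect : ∀ t m kn kl A r a →
      t + m * (kn + (kl + 2 * (m + 2) * A)) + ((kl + 2 * (m + 2) * A) + 2 * r + (1 + m) * (2 * (m + 2)) * a)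
      ≡ t + (m * kn + (1 + m) * kl + 2 * r) + (1 + m) * (2 * (m + 2)) * (A + a)
    collect = solve-∀
    identity : ∀ m K S →
      2 * (m + 2) * (2 * S)
        + (m * (K * ((K + 1) + (K + K * m))) + (1 + m) * (K * ((K + 1) + K * m)) + 2 * ((m + 2) * K * (m + (K + 1))))
        + (1 + m) * (2 * (m + 2)) * (2 * S)
      ≡ 2 * (2 * ((m + 2) * (m + 2)) * S)
        + ((K + 1) * K + K * (m * 2) + (1 + m) * (2 * (m + 2)) * ((K + 1) * K))
    identity = solve-∀

open import Data.Nat using (ℕ; _≤_)
import Data.Nat as ℕ
open import Data.Integer using (ℤ; +_; _+_; _-_; _*_)
open import Data.Integer.Properties using (pos-+; pos-*)
open import Data.Integer.Tactic.RingSolver using (solve-∀)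

ℕ-identity-to-ℤ : ∀ m K N S S⋆ → K ℕ.+ 1 ≡ N →
  S⋆ ℕ.+ (m ℕ.+ 2) ℕ.* K ℕ.* (m ℕ.+ N) ≡ 2 ℕ.* ((m ℕ.+ 2) ℕ.* (m ℕ.+ 2)) ℕ.* S →
  + S⋆ ≡ + 2 * ((+ m + + 2) * (+ m + + 2)) * + S - (+ m + + 2) * (+ N - + 1) * (+ m + + N)
ℕ-identity-to-ℤ m K N S S⋆ K+1≡N eq = begin
    + S⋆
  ≡⟨ add-subtract (+ S⋆) R ⟩
    + S⋆ + R - R
  ≡⟨ cong (_- R) (trans (cong (λ r → + S⋆ + r) (sym R-cast)) (trans (sym (pos-+ S⋆ _)) (trans (cong +_ eq) Q-cast))) ⟩
    Q - R
  ≡⟨ cong (λ z → Q - (+ m + + 2) * z * (+ m + + N)) K≡N-1 ⟩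
    Q - (+ m + + 2) * (+ N - + 1) * (+ m + + N) ∎
  where
  open ≡-Reasoning
  R Q : ℤ
  R = (+ m + + 2) * + K * (+ m + + N)
  Q = + 2 * ((+ m + + 2) * (+ m + + 2)) * + S

  add-subtract : ∀ x y → x ≡ x + y - y
  add-subtract = solve-∀
  add-subtract-1 : ∀ x → x ≡ x + + 1 - + 1
  add-subtract-1 = solve-∀

  R-cast : + ((m ℕ.+ 2) ℕ.* K ℕ.* (m ℕ.+ N)) ≡ R
  R-cast = trans (pos-* ((m ℕ.+ 2) ℕ.* K) (m ℕ.+ N))
             (cong₂ _*_ (trans (pos-* (m ℕ.+ 2) K) (cong (_* + K) (pos-+ m 2))) (pos-+ m N))

  Q-cast : + (2 ℕ.* ((m ℕ.+ 2) ℕ.* (m ℕ.+ 2)) ℕ.* S) ≡ Q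
  Q-cast = trans (pos-* (2 ℕ.* ((m ℕ.+ 2) ℕ.* (m ℕ.+ 2))) S) (cong (_* + S)
             (trans (pos-* 2 ((m ℕ.+ 2) ℕ.* (m ℕ.+ 2)))
               (cong (+ 2 *_) (trans (pos-* (m ℕ.+ 2) (m ℕ.+ 2)) (cong₂ _*_ (pos-+ m 2) (pos-+ m 2))))))

  K≡N-1 : + K ≡ + N - + 1
  K≡N-1 = trans (add-subtract-1 (+ K)) (cong (_- + 1) (trans (sym (pos-+ K 1)) (cong +_ K+1≡N)))

theorem3 : (T : Graph) → IsTree T → (m : ℕ) → 1 ≤ m →
    (d : DistFun T) → IsDistance T d →
    (d⋆ : DistFun (starFractal m T)) → IsDistance (starFractal m T) d⋆ →
    + GeodesicDistance (starFractal m T) d⋆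
      ≡ + 2 * ((+ m + + 2) * (+ m + + 2)) * + GeodesicDistance T d
        - (+ m + + 2) * (+ n T - + 1) * (+ m + + n T)
-- The formula holds for m = 0 as well.
theorem3 T tree m _ d d-is-distance d⋆ d⋆-is-distance =
  ℕ-identity-to-ℤ m (k T) (n T) (GeodesicDistance T d) (GeodesicDistance (starFractal m T) d⋆) tree-edge-count
    (star-fractal-arithmetic m (k T) (n T) _ _ _ _ _ _
      tree-edge-count ∑-columns ∑-column-old ∑-column-mid ∑∑-edge-distance ∑-column-pend)
  where
  open DistancesInTree T tree d d-is-distance using (tree-edge-count; ∑∑-edge-distance)
  open StarOfTree m T tree d d-is-distance d⋆ d⋆-is-distance
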